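{- Let $\Sigma=\{a_1,\dots,a_\sigma\}$ be an ordered alphabet with $a_1<\dots<a_\sigma$. For any $\sigma$ and $n$ such that $\sigma<n$, write $n=m\sigma+p$ with integers $m$ and $0\le p<\sigma$. Then the maximum, over all strings $w\in\Sigma^n$, of the total number of Lyndon subsequences of $w$ is \[ \mathit{MTS}(\sigma,n)=2^n-(p+\sigma)2^m+n+\sigma-1 . \] Moreover, the number of strings in $\Sigma^n$ that contain exactly $\mathit{MTS}(\sigma,n)$ Lyndon subsequences is $\binom{\sigma}{p}$, and the string $w={a_1}^m\cdots{a_{\sigma-p}}^m\,{a_{\sigma-p+1}}^{m+1}\cdots{a_\sigma}^{m+1}$ is one such string.
   Context: A string $w$ over an ordered alphabet is a Lyndon word if it is non-empty and lexicographically strictly smaller than all its non-empty proper suffixes (equivalently, it is the lexicographically smallest among its conjugates $vu$, where $w=uv$). A subsequence $x$ of $w$ occurs at a set of positions $\{i_1<\dots<i_{|x|}\}\subseteq\{1,\dots,|w|\}$ if $x=w[i_1]\cdots w[i_{|x|}]$. The total number of Lyndon subsequences of $w$ is the number of non-empty position sets $\{i_1<\dots<i_k\}$ such that $w[i_1]\cdots w[i_k]$ is a Lyndon word (occurrences are counted, not distinct strings). $\mathit{MTS}(\sigma,n)$ denotes the maximum of this quantity over all strings of length $n$ over an alphabet of size $\sigma$. -}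

module Defs where

open import Data.Nat as ℕ using (ℕ; zero; suc; _⊔_; _≤_; _<_; _∸_)
open import Data.Bool using (Bool; true; false)
open import Data.Fin as Fin using (Fin)
open import Data.Fin.Properties as FinP using ()
open import Data.List using (List; []; _∷_; length; map; concatMap; filter; foldr; allFin; replicate; _++_)
open import Data.List.Relation.Unary.All using (All; all?)
open import Data.List.Relation.Binary.Lex.Strict using (Lex-<; <-decidable)
open import Data.Vec as Vec using (Vec; []; _∷_; toList)
open import Data.Empty using (⊥)
open import Relation.Binary.PropositionalEquality using (_≡_)
open import Relation.Nullary using (Dec; yes; no)
open import Relation.Nullary.Decidable using (⌊_⌋)
import Data.Nat.Properties as ℕP

-- The ordered alphabet Σ = {a₁ < … < a_σ} is Fin σ with its usual order.
-- Strings over Σ are lists of letters.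
Word : ℕ → Set
Word σ = List (Fin σ)

-- Strict lexicographic order on words (a proper prefix is smaller).
_<ₗ_ : ∀ {σ} → Word σ → Word σ → Set
_<ₗ_ = Lex-< _≡_ Fin._<_

_<ₗ?_ : ∀ {σ} (u v : Word σ) → Dec (u <ₗ v)
u <ₗ? v = <-decidable Fin._≟_ FinP._<?_ u v

nonemptySuffixes : ∀ {σ} → Word σ → List (Word σ)
nonemptySuffixes []       = []
nonemptySuffixes (x ∷ xs) = (x ∷ xs) ∷ nonemptySuffixes xs

properSuffixes : ∀ {σ} → Word σ → List (Word σ)
properSuffixes []       = []
properSuffixes (x ∷ xs) = nonemptySuffixes xs

IsLyndon : ∀ {σ} → Word σ → Set
IsLyndon []         = ⊥
IsLyndon w@(_ ∷ _)  = All (w <ₗ_) (properSuffixes w)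

isLyndon? : ∀ {σ} (w : Word σ) → Dec (IsLyndon w)
isLyndon? []         = no (λ ())
isLyndon? w@(_ ∷ _)  = all? (w <ₗ?_) (properSuffixes w)

allVecs : ∀ {A : Set} → List A → (n : ℕ) → List (Vec A n)
allVecs xs zero    = [] ∷ []
allVecs xs (suc n) = concatMap (λ x → map (x ∷_) (allVecs xs n)) xs

-- A position set of a word of length k: a characteristic vector in Vec Bool k.
-- The subsequence of w at the chosen positions.
select : ∀ {A : Set} {k} → Vec A k → Vec Bool k → List A
select []       []           = []
select (x ∷ xs) (true  ∷ bs) = x ∷ select xs bs
select (x ∷ xs) (false ∷ bs) = select xs bs

-- Total number of Lyndon subsequences (occurrences = position sets counted).
totalLyndonSubseq : ∀ {σ} → Word σ → ℕ
totalLyndonSubseq w =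
  length (filter (λ S → isLyndon? (select (Vec.fromList w) S))
                 (allVecs (true ∷ false ∷ []) (length w)))

allStrings : (σ n : ℕ) → List (Word σ)
allStrings σ n = map toList (allVecs (allFin σ) n)

MTS : ℕ → ℕ → ℕ
MTS σ n = foldr _⊔_ 0 (map totalLyndonSubseq (allStrings σ n))

numMaximal : ℕ → ℕ → ℕ
numMaximal σ n =
  length (filter (λ w → totalLyndonSubseq w ℕ.≟ MTS σ n) (allStrings σ n))

-- The string a₁^m ⋯ a_{σ-p}^m a_{σ-p+1}^{m+1} ⋯ a_σ^{m+1}
-- (letter with 0-based index i is repeated m times if i < σ ∸ p, else m+1).
extremalWord : (σ m p : ℕ) → Word σ
extremalWord σ m p =
  concatMap (λ i → replicate (if⌊ Fin.toℕ i ℕ.<? σ ∸ p ⌋ m (suc m)) i) (allFin σ)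
  where
    if⌊_⌋ : ∀ {P : Set} → Dec P → ℕ → ℕ → ℕ
    if⌊ yes _ ⌋ a b = a
    if⌊ no _  ⌋ a b = b

-- A subsequence x s in which x is ≤ every letter of s is Lyndon unless s = x^j with j ≥ 1, and
-- x^(j+1) never is. So at most 2^|w| − (2^(|w|_x) − 1) of the subsequences of x w through its first
-- position are Lyndon, with equality when x w is sorted and strict inequality when w contains a
-- letter smaller than x. Summing over positions, the number T(w) of Lyndon subsequences satisfies
--   T(w) + Φ(w) + 1 ≤ 2^n + n + σ,   where Φ(w) = Σ_a 2^(|w|_a),
-- with equality exactly for sorted w. Comparing the convex function c ↦ 2^c with its chord through
-- c = m and c = m + 1 gives Φ(w) ≥ (p + σ) 2^m, with equality exactly when every letter occurs m or
-- m + 1 times. The maximal words are thus the sorted words in which some p letters occur m + 1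
-- times and the others m times.

module Submission where

open import Defs
open import Data.Nat using (ℕ; _+_; _*_; _^_; _<_)
open import Data.Nat.Combinatorics using (_C_)
open import Data.Integer as ℤ using (ℤ; +_)
open import Data.List using (length)
open import Data.Product using (_×_)
open import Relation.Binary.PropositionalEquality using (_≡_)

open import Data.Bool using (Bool; true; false; if_then_else_)
open import Data.Empty using (⊥; ⊥-elim)
open import Data.Fin as Fin using (Fin; toℕ)
import Data.Fin.Properties as Finₚ
open import Data.Fin.Subset using (Subset; ∣_∣)
import Data.Integer.Properties as ℤₚ
import Data.Integer.Tactic.RingSolver as ℤ-Solver
open import Data.List
  using (List; []; _∷_; _++_; map; filter; foldr; replicate; concatMap; allFin; cartesianProductWith)
import Data.List.Properties as Listₚ
open import Data.List.Membership.Propositional using (_∈_; find)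
open import Data.List.Membership.Propositional.Properties
  using (∈-map⁺; ∈-map⁻; ∈-filter⁺; ∈-filter⁻; ∈-allFin; ∈-cartesianProductWith⁺)
open import Data.List.Membership.Propositional.Properties.WithK using (unique∧set⇒bag)
open import Data.List.Relation.Binary.BagAndSetEquality using (∼bag⇒↭)
open import Data.List.Relation.Binary.Lex.Core using (this; next)
open import Data.List.Relation.Binary.Permutation.Propositional.Properties using (↭-length)
open import Data.List.Relation.Binary.Sublist.Propositional as Sublist using ([]; _∷_; _∷ʳ_)
open import Data.List.Relation.Binary.Sublist.Propositional.Properties using (All-resp-⊆)
open import Data.List.Relation.Unary.All as All using (All; []; _∷_; all?)
import Data.List.Relation.Unary.All.Properties as Allₚ
open import Data.List.Relation.Unary.AllPairs using (AllPairs; []; _∷_; allPairs?)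
import Data.List.Relation.Unary.AllPairs.Properties as AllPairsₚ
open import Data.List.Relation.Unary.Any using (here; there)
open import Data.List.Relation.Unary.Unique.Propositional using (Unique)
import Data.List.Relation.Unary.Unique.Propositional.Properties as Uniqueₚ
open import Data.Nat using (zero; suc; _≤_; _∸_; _⊔_; z≤n; s≤s)
open import Data.Nat.Combinatorics using (nCk+nC[k+1]≡[n+1]C[k+1]; k>n⇒nCk≡0)
import Data.Nat.Properties as ℕ
open import Data.Nat.Tactic.RingSolver using (solve-∀)
open import Data.Product using (∃-syntax; _,_; proj₁; proj₂)
open import Data.Sum using (_⊎_; inj₁; inj₂; map₂)
open import Data.Vec as Vec using (Vec; []; _∷_; fromList; toList; lookup; tabulate)
import Data.Vec.Properties as Vecₚ
open import Function using (id; _∘_; _∋_; _⇔_; mk⇔; Equivalence)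
open import Level using (0ℓ)
open import Relation.Binary.Definitions using (tri<; tri≈; tri>)
open import Relation.Binary.PropositionalEquality
  using (_≢_; refl; sym; trans; cong; cong₂; subst; module ≡-Reasoning)
open import Relation.Nullary using (¬_; Dec; yes; no; does)
open import Relation.Nullary.Decidable using (dec-true; dec-false)
open import Relation.Unary using (Pred; Decidable; _⊆_; _≐_; ∁)
open import Relation.Unary.Properties using (∁?)

import Algebra.Properties.CommutativeSemigroup ℕ.+-commutativeSemigroup as +-Comm
open import Algebra.Properties.Monoid.Sum ℕ.+-0-monoid using (sum-cong-≗; sum-syntax)

private
  variable
    A B : Set
    σ k n : ℕ

module _ {P Q : Pred A 0ℓ} (P? : Decidable P) (Q? : Decidable Q) where

  length-filter-mono : P ⊆ Q → ∀ xs → length (filter P? xs) ≤ length (filter Q? xs)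
  length-filter-mono P⊆Q []       = z≤n
  length-filter-mono P⊆Q (x ∷ xs) with P? x | Q? x
  ... | yes _  | yes _ = s≤s (length-filter-mono P⊆Q xs)
  ... | yes px | no ¬qx = ⊥-elim (¬qx (P⊆Q px))
  ... | no _   | yes _ = ℕ.m≤n⇒m≤1+n (length-filter-mono P⊆Q xs)
  ... | no _   | no _  = length-filter-mono P⊆Q xs

  length-filter-mono-< : P ⊆ Q → ∀ {x xs} → x ∈ xs → Q x → ¬ P x →
                         length (filter P? xs) < length (filter Q? xs)
  length-filter-mono-< P⊆Q {xs = y ∷ xs} (here refl) qx ¬px with P? y | Q? y
  ... | yes py | _      = ⊥-elim (¬px py)
  ... | no _   | yes _  = s≤s (length-filter-mono P⊆Q xs)
  ... | no _   | no ¬qy = ⊥-elim (¬qy qx)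
  length-filter-mono-< P⊆Q {xs = y ∷ xs} (there x∈xs) qx ¬px with P? y | Q? y
  ... | yes _  | yes _  = s≤s (length-filter-mono-< P⊆Q x∈xs qx ¬px)
  ... | yes py | no ¬qy = ⊥-elim (¬qy (P⊆Q py))
  ... | no _   | yes _  = ℕ.m≤n⇒m≤1+n (length-filter-mono-< P⊆Q x∈xs qx ¬px)
  ... | no _   | no _   = length-filter-mono-< P⊆Q x∈xs qx ¬px

module _ {P : Pred A 0ℓ} (P? : Decidable P) where

  length-filter-∁ : ∀ xs → length (filter P? xs) + length (filter (∁? P?) xs) ≡ length xs
  length-filter-∁ []       = refl
  length-filter-∁ (x ∷ xs) with P? x
  ... | yes _ = cong suc (length-filter-∁ xs)
  ... | no _  = trans (ℕ.+-suc _ _) (cong suc (length-filter-∁ xs))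

  length-filter-map : (f : B → A) → ∀ xs → length (filter P? (map f xs)) ≡ length (filter (P? ∘ f) xs)
  length-filter-map f []       = refl
  length-filter-map f (x ∷ xs) with P? (f x)
  ... | yes _ = cong suc (length-filter-map f xs)
  ... | no _  = length-filter-map f xs

∑-mono-≤ : {f g : Fin σ → ℕ} → (∀ a → f a ≤ g a) → ∑[ a < σ ] f a ≤ ∑[ a < σ ] g a
∑-mono-≤ {σ = zero}  f≤g = z≤n
∑-mono-≤ {σ = suc σ} f≤g = ℕ.+-mono-≤ (f≤g Fin.zero) (∑-mono-≤ (f≤g ∘ Fin.suc))

∑-mono-< : {f g : Fin σ → ℕ} → (∀ a → f a ≤ g a) → (x : Fin σ) → f x < g x → ∑[ a < σ ] f a < ∑[ a < σ ] g a
∑-mono-< {σ = suc σ} f≤g Fin.zero    fx<gx = ℕ.+-mono-<-≤ fx<gx (∑-mono-≤ (f≤g ∘ Fin.suc))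
∑-mono-< {σ = suc σ} f≤g (Fin.suc x) fx<gx = ℕ.+-mono-≤-< (f≤g Fin.zero) (∑-mono-< (f≤g ∘ Fin.suc) x fx<gx)

∑-distrib-+ : (f g : Fin σ → ℕ) → ∑[ a < σ ] (f a + g a) ≡ ∑[ a < σ ] f a + ∑[ a < σ ] g a
∑-distrib-+ {σ = zero}  f g = refl
∑-distrib-+ {σ = suc σ} f g =
  trans (cong (λ s → f Fin.zero + g Fin.zero + s) (∑-distrib-+ (f ∘ Fin.suc) (g ∘ Fin.suc)))
        (+-Comm.interchange (f Fin.zero) (g Fin.zero) _ _)

∑-const : ∀ σ c → ∑[ a < σ ] c ≡ σ * c
∑-const zero    c = refl
∑-const (suc σ) c = cong (λ s → c + s) (∑-const σ c)

∑-*-distribˡ : (c : ℕ) (f : Fin σ → ℕ) → ∑[ a < σ ] (c * f a) ≡ c * ∑[ a < σ ] f a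
∑-*-distribˡ {σ = zero}  c f = sym (ℕ.*-zeroʳ c)
∑-*-distribˡ {σ = suc σ} c f =
  trans (cong (λ s → c * f Fin.zero + s) (∑-*-distribˡ c (f ∘ Fin.suc))) (sym (ℕ.*-distribˡ-+ c (f Fin.zero) _))

∑-update : {f g : Fin σ → ℕ} (x : Fin σ) {c : ℕ} → f x ≡ g x + c → (∀ a → a ≢ x → f a ≡ g a) →
           ∑[ a < σ ] f a ≡ ∑[ a < σ ] g a + c
∑-update {σ = suc σ} {f} {g} Fin.zero {c} fx≡ f≡g = begin
  f Fin.zero + ∑[ a < σ ] f (Fin.suc a)   ≡⟨ cong₂ _+_ fx≡ (sum-cong-≗ (λ a → f≡g (Fin.suc a) λ ())) ⟩
  g Fin.zero + c + ∑[ a < σ ] g (Fin.suc a) ≡⟨ +-Comm.xy∙z≈xz∙y (g Fin.zero) c _ ⟩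
  g Fin.zero + ∑[ a < σ ] g (Fin.suc a) + c ∎
  where open ≡-Reasoning
∑-update {σ = suc σ} {f} {g} (Fin.suc x) {c} fx≡ f≡g =
  trans (cong₂ _+_ (f≡g Fin.zero λ ()) (∑-update x fx≡ (λ a a≢x → f≡g (Fin.suc a) (a≢x ∘ Finₚ.suc-injective))))
        (sym (ℕ.+-assoc (g Fin.zero) _ c))

∑-threshold : ∀ σ {t} m {f : Fin σ → ℕ} → t ≤ σ →
  (∀ a → toℕ a < t → f a ≡ m) → (∀ a → t ≤ toℕ a → f a ≡ suc m) → ∑[ a < σ ] f a ≡ σ * m + (σ ∸ t)
∑-threshold zero    m z≤n _ _ = refl
∑-threshold (suc σ) m {f} z≤n _ f≥ = begin
  ∑[ a < suc σ ] f a     ≡⟨ sum-cong-≗ (λ a → f≥ a z≤n) ⟩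
  ∑[ a < suc σ ] suc m   ≡⟨ ∑-const (suc σ) (suc m) ⟩
  suc σ * suc m          ≡⟨ ℕ.*-suc (suc σ) m ⟩
  suc σ + suc σ * m      ≡⟨ ℕ.+-comm (suc σ) _ ⟩
  suc σ * m + suc σ      ∎
  where open ≡-Reasoning
∑-threshold (suc σ) m (s≤s t≤σ) f< f≥ =
  trans (cong₂ _+_ (f< Fin.zero (s≤s z≤n))
                   (∑-threshold σ m t≤σ (λ a → f< (Fin.suc a) ∘ s≤s) (λ a → f≥ (Fin.suc a) ∘ s≤s)))
        (sym (ℕ.+-assoc m (σ * m) _))

3+n<2^[2+n] : ∀ n → 3 + n < 2 ^ (2 + n)
3+n<2^[2+n] zero    = ℕ.≤-refl
3+n<2^[2+n] (suc n) =
  ℕ.+-mono-≤-< (ℕ.m^n>0 2 (2 + n)) (subst (3 + n <_) (sym (ℕ.+-identityʳ (2 ^ (2 + n)))) (3+n<2^[2+n] n))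

-- The line through the points (m, 2^m) and (m + 1, 2^(m+1)) of the convex function c ↦ 2^c is
-- c ↦ 2^m (1 + c − m); these lemmas compare 2^c with it, written without subtraction.
module _ (m : ℕ) where

  2^-chord-≡ : {c : ℕ} → c ≡ m ⊎ c ≡ suc m → 2 ^ m * (1 + c) ≡ 2 ^ c + m * 2 ^ m
  2^-chord-≡ (inj₁ refl) = rearrange (2 ^ m) m
    where
      rearrange : ∀ P m → P * (1 + m) ≡ P + m * P
      rearrange = solve-∀
  2^-chord-≡ (inj₂ refl) = rearrange (2 ^ m) m
    where
      rearrange : ∀ P m → P * (1 + suc m) ≡ 2 * P + m * P
      rearrange = solve-∀

  2^-chord-< : {c : ℕ} → c ≢ m → c ≢ suc m → 2 ^ m * (1 + c) < 2 ^ c + m * 2 ^ m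
  2^-chord-< {c} c≢m c≢1+m with ℕ.<-cmp c m
  ... | tri< c<m _ _ = begin-strict
    2 ^ m * (1 + c)  ≡⟨ ℕ.*-comm (2 ^ m) (1 + c) ⟩
    (1 + c) * 2 ^ m  ≤⟨ ℕ.*-monoˡ-≤ (2 ^ m) c<m ⟩
    m * 2 ^ m        <⟨ ℕ.m<n+m (m * 2 ^ m) (ℕ.m^n>0 2 c) ⟩
    2 ^ c + m * 2 ^ m ∎
    where open ℕ.≤-Reasoning
  ... | tri≈ _ c≡m _ = ⊥-elim (c≢m c≡m)
  ... | tri> _ _ m<c with ℕ.m≤n⇒∃[o]m+o≡n (ℕ.≤∧≢⇒< m<c (c≢1+m ∘ sym))
  ...   | d , refl = begin-strict
    2 ^ m * (1 + (2 + m + d))          ≡⟨ rearrange (2 ^ m) m d ⟩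
    m * 2 ^ m + 2 ^ m * (3 + d)
      <⟨ ℕ.+-monoʳ-< (m * 2 ^ m) (ℕ.*-monoʳ-< (2 ^ m) {{ℕ.m^n≢0 2 m}} (3+n<2^[2+n] d)) ⟩
    m * 2 ^ m + 2 ^ m * 2 ^ (2 + d)    ≡⟨ ℕ.+-comm (m * 2 ^ m) _ ⟩
    2 ^ m * 2 ^ (2 + d) + m * 2 ^ m    ≡⟨ cong (_+ m * 2 ^ m) (ℕ.^-distribˡ-+-* 2 m (2 + d)) ⟨
    2 ^ (m + (2 + d)) + m * 2 ^ m      ≡⟨ cong (λ e → 2 ^ e + m * 2 ^ m) (ℕ.+-suc m (suc d)) ⟩
    2 ^ (suc m + suc d) + m * 2 ^ m    ≡⟨ cong (λ e → 2 ^ e + m * 2 ^ m) (cong suc (ℕ.+-suc m d)) ⟩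
    2 ^ (2 + m + d) + m * 2 ^ m        ∎
    where
      open ℕ.≤-Reasoning
      rearrange : ∀ P m d → P * (1 + (2 + m + d)) ≡ m * P + P * (3 + d)
      rearrange = solve-∀

  2^-chord-≤ : (c : ℕ) → 2 ^ m * (1 + c) ≤ 2 ^ c + m * 2 ^ m
  2^-chord-≤ c with c ℕ.≟ m | c ℕ.≟ suc m
  ... | yes c≡m | _         = ℕ.≤-reflexive (2^-chord-≡ (inj₁ c≡m))
  ... | no _    | yes c≡1+m = ℕ.≤-reflexive (2^-chord-≡ (inj₂ c≡1+m))
  ... | no c≢m  | no c≢1+m  = ℕ.<⇒≤ (2^-chord-< c≢m c≢1+m)

concatMap-map≡cartesianProductWith : {C : Set} (f : A → B → C) → ∀ xs (ys : List B) →
  concatMap (λ x → map (f x) ys) xs ≡ cartesianProductWith f xs ys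
concatMap-map≡cartesianProductWith f []       ys = refl
concatMap-map≡cartesianProductWith f (x ∷ xs) ys =
  cong (map (f x) ys ++_) (concatMap-map≡cartesianProductWith f xs ys)

allVecs-suc : (xs : List A) (n : ℕ) → allVecs xs (suc n) ≡ cartesianProductWith _∷_ xs (allVecs xs n)
allVecs-suc xs n = concatMap-map≡cartesianProductWith _∷_ xs (allVecs xs n)

∈-allVecs : {xs : List A} → (∀ x → x ∈ xs) → (v : Vec A n) → v ∈ allVecs xs n
∈-allVecs ∈xs []      = here refl
∈-allVecs {xs = xs} ∈xs (x ∷ v) =
  subst (_ ∈_) (sym (allVecs-suc xs _)) (∈-cartesianProductWith⁺ _∷_ (∈xs x) (∈-allVecs ∈xs v))

allVecs-unique : {xs : List A} → Unique xs → ∀ n → Unique (allVecs xs n)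
allVecs-unique xs! zero    = [] ∷ []
allVecs-unique {xs = xs} xs! (suc n) =
  subst Unique (sym (allVecs-suc xs n))
    (Uniqueₚ.cartesianProductWith⁺ _∷_ Vecₚ.∷-injective xs! (allVecs-unique xs! n))

subsets : (k : ℕ) → List (Vec Bool k)
subsets = allVecs (true ∷ false ∷ [])

∈-subsets : (S : Vec Bool k) → S ∈ subsets k
∈-subsets = ∈-allVecs λ { true → here refl ; false → there (here refl) }

subsets-unique : ∀ k → Unique (subsets k)
subsets-unique = allVecs-unique (((λ ()) ∷ []) ∷ [] ∷ [])

length-subsets : ∀ k → length (subsets k) ≡ 2 ^ k
length-subsets zero    = refl
length-subsets (suc k) = begin
  length (map (true ∷_) (subsets k) ++ map (false ∷_) (subsets k) ++ [])
    ≡⟨ Listₚ.length-++ (map (true ∷_) (subsets k)) ⟩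
  length (map (true ∷_) (subsets k)) + length (map (false ∷_) (subsets k) ++ [])
    ≡⟨ cong₂ _+_ (Listₚ.length-map _ (subsets k))
                 (trans (Listₚ.length-++ (map (false ∷_) (subsets k))) (ℕ.+-identityʳ _)) ⟩
  length (subsets k) + length (map (false ∷_) (subsets k))
    ≡⟨ cong₂ _+_ (length-subsets k) (trans (Listₚ.length-map _ (subsets k)) (length-subsets k)) ⟩
  2 ^ k + 2 ^ k
    ≡⟨ cong (λ x → 2 ^ k + x) (sym (ℕ.+-identityʳ (2 ^ k))) ⟩
  2 ^ suc k ∎
  where open ≡-Reasoning

length-filter-subsets-suc : {Q : Pred (Vec Bool (suc k)) 0ℓ} (Q? : Decidable Q) →
  length (filter Q? (subsets (suc k)))
    ≡ length (filter (Q? ∘ (true ∷_)) (subsets k)) + length (filter (Q? ∘ (false ∷_)) (subsets k))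
length-filter-subsets-suc {k} Q? = begin
  length (filter Q? (map (true ∷_) (subsets k) ++ map (false ∷_) (subsets k) ++ []))
    ≡⟨ cong length (Listₚ.filter-++ Q? (map (true ∷_) (subsets k)) _) ⟩
  length (filter Q? (map (true ∷_) (subsets k)) ++ filter Q? (map (false ∷_) (subsets k) ++ []))
    ≡⟨ Listₚ.length-++ (filter Q? (map (true ∷_) (subsets k))) ⟩
  length (filter Q? (map (true ∷_) (subsets k))) + length (filter Q? (map (false ∷_) (subsets k) ++ []))
    ≡⟨ cong₂ _+_ (length-filter-map Q? (true ∷_) (subsets k))
                 (trans (cong (λ l → length (filter Q? l)) (Listₚ.++-identityʳ (map (false ∷_) (subsets k))))
                        (length-filter-map Q? (false ∷_) (subsets k))) ⟩
  length (filter (Q? ∘ (true ∷_)) (subsets k)) + length (filter (Q? ∘ (false ∷_)) (subsets k)) ∎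
  where open ≡-Reasoning

#subsets-of-size : ∀ σ p → length (filter (λ b → ∣ b ∣ ℕ.≟ p) (subsets σ)) ≡ σ C p
#subsets-of-size zero    zero    = refl
#subsets-of-size zero    (suc p) = sym (k>n⇒nCk≡0 {0} {suc p} (s≤s z≤n))
#subsets-of-size (suc σ) p       = trans (length-filter-subsets-suc {k = σ} (λ b → ∣ b ∣ ℕ.≟ p)) (pascal p)
  where
    #size : (ℕ → ℕ) → ℕ → ℕ
    #size f p = length (filter (λ (b : Subset σ) → f ∣ b ∣ ℕ.≟ p) (subsets σ))
    pascal : ∀ p → #size suc p + #size id p ≡ suc σ C p
    pascal zero    = trans (cong (_+ #size id 0) (cong length (Listₚ.filter-none (λ b → suc ∣ b ∣ ℕ.≟ 0) no-size-0)))
                           (#subsets-of-size σ 0)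
      where
        no-size-0 = All.universal (λ _ ()) (subsets σ)
    pascal (suc p) = begin
      #size suc (suc p) + #size id (suc p)
        ≡⟨ cong (_+ #size id (suc p))
                (cong length (Listₚ.filter-≐ (λ b → suc ∣ b ∣ ℕ.≟ suc p) (λ b → ∣ b ∣ ℕ.≟ p)
                                             (ℕ.suc-injective , cong suc) (subsets σ))) ⟩
      #size id p + #size id (suc p)
        ≡⟨ cong₂ _+_ (#subsets-of-size σ p) (#subsets-of-size σ (suc p)) ⟩
      σ C p + σ C suc p
        ≡⟨ nCk+nC[k+1]≡[n+1]C[k+1] σ p ⟩
      suc σ C suc p ∎
      where open ≡-Reasoning

#subseq : {P : Pred (List A) 0ℓ} → Decidable P → Vec A k → ℕ
#subseq {k = k} P? v = length (filter (P? ∘ select v) (subsets k))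

module _ {P Q : Pred (List A) 0ℓ} (P? : Decidable P) (Q? : Decidable Q) where

  #subseq-mono : P ⊆ Q → (v : Vec A k) → #subseq P? v ≤ #subseq Q? v
  #subseq-mono {k} P⊆Q v = length-filter-mono (P? ∘ select v) (Q? ∘ select v) P⊆Q (subsets k)

  #subseq-mono-< : P ⊆ Q → (v : Vec A k) (S : Vec Bool k) → Q (select v S) → ¬ P (select v S) →
                   #subseq P? v < #subseq Q? v
  #subseq-mono-< {k} P⊆Q v S =
    length-filter-mono-< (P? ∘ select v) (Q? ∘ select v) P⊆Q {xs = subsets k} (∈-subsets S)

  #subseq-cong : (v : Vec A k) → (P ∘ select v) ≐ (Q ∘ select v) → #subseq P? v ≡ #subseq Q? v
  #subseq-cong {k} v P≐Q = cong length (Listₚ.filter-≐ (P? ∘ select v) (Q? ∘ select v) P≐Q (subsets k))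

module _ {P : Pred (List A) 0ℓ} (P? : Decidable P) where

  #subseq-∷ : (x : A) (v : Vec A k) → #subseq P? (x ∷ v) ≡ #subseq (P? ∘ (x ∷_)) v + #subseq P? v
  #subseq-∷ x v = length-filter-subsets-suc (P? ∘ select (x ∷ v))

  #subseq-∁ : (v : Vec A k) → #subseq P? v + #subseq (∁? P?) v ≡ 2 ^ k
  #subseq-∁ {k} v = trans (length-filter-∁ (P? ∘ select v) (subsets k)) (length-subsets k)

  #subseq-none : (∀ s → ¬ P s) → (v : Vec A k) → #subseq P? v ≡ 0
  #subseq-none {k} ¬P v =
    cong length (Listₚ.filter-none (P? ∘ select v) (All.universal (λ S → ¬P (select v S)) (subsets k)))

select-⊆ : (xs : List A) (S : Vec Bool (length xs)) → select (fromList xs) S Sublist.⊆ xs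
select-⊆ []       []           = []
select-⊆ (x ∷ xs) (true  ∷ S) = refl ∷ select-⊆ xs S
select-⊆ (x ∷ xs) (false ∷ S) = x ∷ʳ select-⊆ xs S

select-singleton : {y : A} {xs : List A} → y ∈ xs → ∃[ S ] select (fromList xs) S ≡ y ∷ []
select-singleton {xs = x ∷ xs} (here refl)  =
  true ∷ Vec.replicate (length xs) false , cong (x ∷_) (select-nothing xs)
  where
    select-nothing : (xs : List A) → select (fromList xs) (Vec.replicate (length xs) false) ≡ []
    select-nothing []       = refl
    select-nothing (x ∷ xs) = select-nothing xs
select-singleton {xs = x ∷ xs} (there y∈xs) with select-singleton y∈xs
... | S , eq = false ∷ S , eq

AllPairs-resp-⊆ : {R : A → A → Set} {xs ys : List A} → xs Sublist.⊆ ys → AllPairs R ys → AllPairs R xs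
AllPairs-resp-⊆ []              []          = []
AllPairs-resp-⊆ (_    ∷ʳ xs⊆ys) (_ ∷ rys)   = AllPairs-resp-⊆ xs⊆ys rys
AllPairs-resp-⊆ (refl ∷  xs⊆ys) (ry ∷ rys) = All-resp-⊆ xs⊆ys ry ∷ AllPairs-resp-⊆ xs⊆ys rys

AllPairs-replicate : {R : A → A → Set} {x : A} → R x x → ∀ k → AllPairs R (replicate k x)
AllPairs-replicate Rxx zero    = []
AllPairs-replicate Rxx (suc k) = Allₚ.replicate⁺ k Rxx ∷ AllPairs-replicate Rxx k

-- Sorted words and Lyndon words

Sorted : Word σ → Set
Sorted = AllPairs Fin._≤_

IsPower⁺ : Fin σ → Word σ → Set
IsPower⁺ x []      = ⊥
IsPower⁺ x (y ∷ s) = All (_≡ x) (y ∷ s)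

isPower⁺? : (x : Fin σ) → Decidable (IsPower⁺ x)
isPower⁺? x []      = no λ ()
isPower⁺? x (y ∷ s) = all? (Fin._≟ x) (y ∷ s)

module _ {σ : ℕ} where

  All-nonemptySuffixes : {P : Pred (Fin σ) 0ℓ} {s v : Word σ} → v ∈ nonemptySuffixes s → All P s → All P v
  All-nonemptySuffixes {s = _ ∷ _} (here refl) ps       = ps
  All-nonemptySuffixes {s = _ ∷ _} (there v∈) (_ ∷ ps) = All-nonemptySuffixes v∈ ps

  nonemptySuffixes-tail : {y z : Fin σ} {v s : Word σ} →
    (y ∷ v) ∈ nonemptySuffixes (z ∷ s) → v ≡ [] ⊎ v ∈ nonemptySuffixes s
  nonemptySuffixes-tail {s = []}    (here refl) = inj₁ refl
  nonemptySuffixes-tail {s = []}    (there ())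
  nonemptySuffixes-tail {s = _ ∷ _} (here refl) = inj₂ (here refl)
  nonemptySuffixes-tail {s = _ ∷ _} (there v∈)  = map₂ there (nonemptySuffixes-tail v∈)

  []∉nonemptySuffixes : {s : Word σ} → ¬ [] ∈ nonemptySuffixes s
  []∉nonemptySuffixes {_ ∷ _} (there []∈) = []∉nonemptySuffixes []∈

  sorted-last-max : {y : Fin σ} {s : Word σ} → Sorted s → (y ∷ []) ∈ nonemptySuffixes s → All (Fin._≤ y) s
  sorted-last-max {s = _ ∷ _} _             (here refl) = Finₚ.≤-refl ∷ []
  sorted-last-max {s = _ ∷ _} (z≤s ∷ sorted) (there y∈) =
    All.head (All-nonemptySuffixes y∈ z≤s) ∷ sorted-last-max sorted y∈

  -- Write s = x^j t, all letters of t being > x (t ≠ [] as s is not all x). A nonempty suffix of s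
  -- is x^i t′ with i ≤ j and t′ a nonempty suffix of t, so comparing it with x ∷ s = x^(i+1) ⋯
  -- meets a letter > x against x at position i + 1.
  <ₗ-nonemptySuffixes : {x : Fin σ} {s v : Word σ} →
    Sorted (x ∷ s) → ¬ All (_≡ x) s → v ∈ nonemptySuffixes s → (x ∷ s) <ₗ v
  <ₗ-nonemptySuffixes {v = []} _ _ []∈ = ⊥-elim ([]∉nonemptySuffixes []∈)
  <ₗ-nonemptySuffixes {x} {z ∷ s} {y ∷ v} (x≤zs ∷ z≤s ∷ sorted) ¬s≡x v∈ with x Finₚ.<? y
  ... | yes x<y = this x<y
  ... | no x≮y  = next (sym y≡x) (subst (λ z → (z ∷ s) <ₗ v) (sym z≡x) (from-tail (nonemptySuffixes-tail v∈)))
    where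
      y≡x : y ≡ x
      y≡x = Finₚ.≤-antisym (ℕ.≮⇒≥ x≮y) (All.head (All-nonemptySuffixes v∈ x≤zs))
      z≡x : z ≡ x
      z≡x = Finₚ.≤-antisym (subst (z Fin.≤_) y≡x (All.head (All-nonemptySuffixes v∈ (Finₚ.≤-refl ∷ z≤s))))
                            (All.head x≤zs)
      from-tail : v ≡ [] ⊎ v ∈ nonemptySuffixes s → (x ∷ s) <ₗ v
      from-tail (inj₁ refl) =
        ⊥-elim (¬s≡x (All.zipWith (λ (x≤w , w≤y) → Finₚ.≤-antisym (subst (_ Fin.≤_) y≡x w≤y) x≤w)
                                  (x≤zs , sorted-last-max (z≤s ∷ sorted) v∈)))
      from-tail (inj₂ v∈s)  = <ₗ-nonemptySuffixes (All.tail x≤zs ∷ sorted) (λ s≡x → ¬s≡x (z≡x ∷ s≡x)) v∈s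

  sorted∧¬power⁺⇒lyndon : {x : Fin σ} {s : Word σ} → Sorted (x ∷ s) → ¬ IsPower⁺ x s → IsLyndon (x ∷ s)
  sorted∧¬power⁺⇒lyndon {s = []}    _      _      = []
  sorted∧¬power⁺⇒lyndon {s = _ ∷ _} sorted ¬power = All.tabulate (<ₗ-nonemptySuffixes sorted ¬power)

  power⁺⇒¬lyndon : {x : Fin σ} {s : Word σ} → IsPower⁺ x s → ¬ IsLyndon (x ∷ s)
  power⁺⇒¬lyndon {s = _ ∷ _} s≡x (x∷s<s ∷ _) = x∷s≮ₗs s≡x x∷s<s
    where
      x∷s≮ₗs : {x : Fin σ} {s : Word σ} → All (_≡ x) s → ¬ (x ∷ s) <ₗ s
      x∷s≮ₗs {s = []}    _            ()
      x∷s≮ₗs {s = _ ∷ _} (refl ∷ _)   (this x<x)    = Finₚ.<-irrefl refl x<x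
      x∷s≮ₗs {s = _ ∷ _} (refl ∷ s≡x) (next _ s<s) = x∷s≮ₗs s≡x s<s

  descent⇒¬lyndon : {x y : Fin σ} → y Fin.< x → ¬ IsLyndon (x ∷ y ∷ [])
  descent⇒¬lyndon y<x (this x<y ∷ _)    = Finₚ.<-asym x<y y<x
  descent⇒¬lyndon y<x (next refl _ ∷ _) = Finₚ.<-irrefl refl y<x

occ : Fin σ → Word σ → ℕ
occ a w = length (filter (Fin._≟ a) w)

module _ {σ : ℕ} where

  occ-∷-≡ : (x : Fin σ) (w : Word σ) → occ x (x ∷ w) ≡ suc (occ x w)
  occ-∷-≡ x w = cong length (Listₚ.filter-accept (Fin._≟ x) {xs = w} refl)

  occ-∷-≢ : {a x : Fin σ} (w : Word σ) → a ≢ x → occ a (x ∷ w) ≡ occ a w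
  occ-∷-≢ w a≢x = cong length (Listₚ.filter-reject (Fin._≟ _) {xs = w} (a≢x ∘ sym))

  ∑-occ : (w : Word σ) → ∑[ a < σ ] occ a w ≡ length w
  ∑-occ []      = trans (∑-const σ 0) (ℕ.*-zeroʳ σ)
  ∑-occ (x ∷ w) = trans (∑-update x (trans (occ-∷-≡ x w) (ℕ.+-comm 1 _)) (λ a → occ-∷-≢ w))
                        (trans (cong (_+ 1) (∑-occ w)) (ℕ.+-comm _ 1))

  occ-++ : (a : Fin σ) (u v : Word σ) → occ a (u ++ v) ≡ occ a u + occ a v
  occ-++ a u v = trans (cong length (Listₚ.filter-++ (Fin._≟ a) u v)) (Listₚ.length-++ (filter (Fin._≟ a) u))

  occ-replicate : (a b : Fin σ) (k : ℕ) → occ a (replicate k b) ≡ (if does (b Fin.≟ a) then k else 0)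
  occ-replicate a b k with b Fin.≟ a
  ... | yes refl =
    trans (cong length (Listₚ.filter-all (Fin._≟ a) (Allₚ.replicate⁺ k refl))) (Listₚ.length-replicate k)
  ... | no b≢a   = cong length (Listₚ.filter-none (Fin._≟ a) (Allₚ.replicate⁺ k b≢a))

  occ-unique : {a : Fin σ} {xs : Word σ} → Unique xs → a ∈ xs → occ a xs ≡ 1
  occ-unique {a} {xs = _ ∷ xs} (a∉xs ∷ _) (here refl) =
    trans (occ-∷-≡ a xs)
          (cong (suc ∘ length) (Listₚ.filter-none (Fin._≟ a) (All.map (λ a≢y y≡a → a≢y (sym y≡a)) a∉xs)))
  occ-unique {xs = _ ∷ xs} (x∉xs ∷ xs!) (there a∈xs) =
    trans (occ-∷-≢ xs (λ a≡x → All.lookup x∉xs a∈xs (sym a≡x))) (occ-unique xs! a∈xs)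

  occ>0⇒∈ : {a : Fin σ} (w : Word σ) → 0 < occ a w → a ∈ w
  occ>0⇒∈ {a} (x ∷ w) occ>0 with x Fin.≟ a
  ... | yes refl = here refl
  ... | no _     = there (occ>0⇒∈ w occ>0)

  occ-∷-cancel : {a : Fin σ} (x : Fin σ) (u v : Word σ) → occ a (x ∷ u) ≡ occ a (x ∷ v) → occ a u ≡ occ a v
  occ-∷-cancel {a} x u v eq with x Fin.≟ a
  ... | yes _ = ℕ.suc-injective eq
  ... | no _  = eq

  sorted-unique : {u v : Word σ} → Sorted u → Sorted v → (∀ a → occ a u ≡ occ a v) → u ≡ v
  sorted-unique {[]}    {[]}    _ _ _ = refl
  sorted-unique {[]}    {y ∷ v} _ _ occ≡ = ⊥-elim (ℕ.0≢1+n (trans (occ≡ y) (occ-∷-≡ y v)))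
  sorted-unique {x ∷ u} {[]}    _ _ occ≡ = ⊥-elim (ℕ.0≢1+n (trans (sym (occ≡ x)) (occ-∷-≡ x u)))
  sorted-unique {x ∷ u} {y ∷ v} sxu@(_ ∷ su) syv@(_ ∷ sv) occ≡ =
    cong₂ _∷_ x≡y (sorted-unique su sv λ a →
      occ-∷-cancel x u v (trans (occ≡ a) (cong (λ z → occ a (z ∷ v)) (sym x≡y))))
    where
      head-≤ : {z b : Fin σ} {t : Word σ} → Sorted (z ∷ t) → b ∈ z ∷ t → z Fin.≤ b
      head-≤ _         (here refl) = Finₚ.≤-refl
      head-≤ (z≤t ∷ _) (there b∈t) = All.lookup z≤t b∈t
      occ-∷->0 : (z : Fin σ) (t : Word σ) → 0 < occ z (z ∷ t)
      occ-∷->0 z t = subst (0 <_) (sym (occ-∷-≡ z t)) (s≤s z≤n)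
      x≡y : x ≡ y
      x≡y = Finₚ.≤-antisym (head-≤ sxu (occ>0⇒∈ (x ∷ u) (subst (0 <_) (sym (occ≡ y)) (occ-∷->0 y v))))
                           (head-≤ syv (occ>0⇒∈ (y ∷ v) (subst (0 <_) (occ≡ x) (occ-∷->0 x u))))

  occ-concatMap-replicate : (h : Fin σ → ℕ) (a : Fin σ) (xs : Word σ) →
    occ a (concatMap (λ b → replicate (h b) b) xs) ≡ h a * occ a xs
  occ-concatMap-replicate h a []       = sym (ℕ.*-zeroʳ (h a))
  occ-concatMap-replicate h a (x ∷ xs) = begin
    occ a (replicate (h x) x ++ concatMap (λ b → replicate (h b) b) xs)
      ≡⟨ occ-++ a (replicate (h x) x) _ ⟩
    occ a (replicate (h x) x) + occ a (concatMap (λ b → replicate (h b) b) xs)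
      ≡⟨ cong₂ _+_ (occ-replicate a x (h x)) (occ-concatMap-replicate h a xs) ⟩
    (if does (x Fin.≟ a) then h x else 0) + h a * occ a xs
      ≡⟨ head-block ⟩
    h a * occ a (x ∷ xs) ∎
    where
      open ≡-Reasoning
      head-block : (if does (x Fin.≟ a) then h x else 0) + h a * occ a xs ≡ h a * occ a (x ∷ xs)
      head-block with x Fin.≟ a
      ... | yes refl = sym (ℕ.*-suc (h x) (occ x xs))
      ... | no _     = refl

blockWord : (Fin σ → ℕ) → Word σ
blockWord {σ} h = concatMap (λ a → replicate (h a) a) (allFin σ)

occ-blockWord : (h : Fin σ → ℕ) (a : Fin σ) → occ a (blockWord h) ≡ h a
occ-blockWord {σ} h a = begin
  occ a (blockWord h)       ≡⟨ occ-concatMap-replicate h a (allFin σ) ⟩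
  h a * occ a (allFin σ)    ≡⟨ cong (h a *_) (occ-unique (Uniqueₚ.allFin⁺ σ) (∈-allFin a)) ⟩
  h a * 1                   ≡⟨ ℕ.*-identityʳ (h a) ⟩
  h a                       ∎
  where open ≡-Reasoning

blockWord-sorted : (h : Fin σ → ℕ) → Sorted (blockWord h)
blockWord-sorted h =
  AllPairsₚ.concat⁺ (Allₚ.map⁺ (All.universal (λ a → AllPairs-replicate Finₚ.≤-refl (h a)) _))
                    (AllPairsₚ.map⁺ (AllPairsₚ.tabulate⁺-< λ a<b →
                       Allₚ.replicate⁺ _ (Allₚ.replicate⁺ _ (ℕ.<⇒≤ a<b))))

-- Counting Lyndon subsequences

module _ {σ : ℕ} where

  #subseq-all≡ : (x : Fin σ) (w : Word σ) → #subseq (all? (Fin._≟ x)) (fromList w) ≡ 2 ^ occ x w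
  #subseq-all≡ x []      = refl
  #subseq-all≡ x (y ∷ w) with y Fin.≟ x
  ... | yes refl = begin
    #subseq (all? (Fin._≟ x)) (fromList (x ∷ w))
      ≡⟨ #subseq-∷ (all? (Fin._≟ x)) x (fromList w) ⟩
    #subseq (all? (Fin._≟ x) ∘ (x ∷_)) (fromList w) + #subseq (all? (Fin._≟ x)) (fromList w)
      ≡⟨ cong (_+ #subseq (all? (Fin._≟ x)) (fromList w))
              (#subseq-cong (all? (Fin._≟ x) ∘ (x ∷_)) (all? (Fin._≟ x)) (fromList w) (All.tail , (refl ∷_))) ⟩
    #subseq (all? (Fin._≟ x)) (fromList w) + #subseq (all? (Fin._≟ x)) (fromList w)
      ≡⟨ cong₂ _+_ (#subseq-all≡ x w) (trans (#subseq-all≡ x w) (sym (ℕ.+-identityʳ _))) ⟩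
    2 ^ suc (occ x w) ∎
    where open ≡-Reasoning
  ... | no y≢x = begin
    #subseq (all? (Fin._≟ x)) (fromList (y ∷ w))
      ≡⟨ #subseq-∷ (all? (Fin._≟ x)) y (fromList w) ⟩
    #subseq (all? (Fin._≟ x) ∘ (y ∷_)) (fromList w) + #subseq (all? (Fin._≟ x)) (fromList w)
      ≡⟨ cong (_+ #subseq (all? (Fin._≟ x)) (fromList w))
              (#subseq-none (all? (Fin._≟ x) ∘ (y ∷_)) (λ _ → y≢x ∘ All.head) (fromList w)) ⟩
    #subseq (all? (Fin._≟ x)) (fromList w)
      ≡⟨ #subseq-all≡ x w ⟩
    2 ^ occ x w ∎
    where open ≡-Reasoning

  #subseq-power⁺ : (x : Fin σ) (w : Word σ) → #subseq (isPower⁺? x) (fromList w) + 1 ≡ 2 ^ occ x w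
  #subseq-power⁺ x []      = refl
  #subseq-power⁺ x (y ∷ w) with y Fin.≟ x
  ... | yes refl = begin
    #subseq (isPower⁺? x) (fromList (x ∷ w)) + 1
      ≡⟨ cong (_+ 1) (#subseq-∷ (isPower⁺? x) x (fromList w)) ⟩
    #subseq (isPower⁺? x ∘ (x ∷_)) (fromList w) + #subseq (isPower⁺? x) (fromList w) + 1
      ≡⟨ ℕ.+-assoc (#subseq (isPower⁺? x ∘ (x ∷_)) (fromList w)) _ 1 ⟩
    #subseq (isPower⁺? x ∘ (x ∷_)) (fromList w) + (#subseq (isPower⁺? x) (fromList w) + 1)
      ≡⟨ cong₂ _+_ (trans (#subseq-cong (isPower⁺? x ∘ (x ∷_)) (all? (Fin._≟ x)) (fromList w) (All.tail , (refl ∷_)))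
                          (#subseq-all≡ x w))
                   (trans (#subseq-power⁺ x w) (sym (ℕ.+-identityʳ _))) ⟩
    2 ^ suc (occ x w) ∎
    where open ≡-Reasoning
  ... | no y≢x = begin
    #subseq (isPower⁺? x) (fromList (y ∷ w)) + 1
      ≡⟨ cong (_+ 1) (#subseq-∷ (isPower⁺? x) y (fromList w)) ⟩
    #subseq (isPower⁺? x ∘ (y ∷_)) (fromList w) + #subseq (isPower⁺? x) (fromList w) + 1
      ≡⟨ cong (λ n → n + #subseq (isPower⁺? x) (fromList w) + 1)
              (#subseq-none (isPower⁺? x ∘ (y ∷_)) (λ _ → y≢x ∘ All.head) (fromList w)) ⟩
    #subseq (isPower⁺? x) (fromList w) + 1
      ≡⟨ #subseq-power⁺ x w ⟩
    2 ^ occ x w ∎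
    where open ≡-Reasoning

  #subseq-¬power⁺ : (x : Fin σ) (w : Word σ) →
    #subseq (∁? (isPower⁺? x)) (fromList w) + 2 ^ occ x w ≡ 2 ^ length w + 1
  #subseq-¬power⁺ x w = begin
    N + 2 ^ occ x w      ≡⟨ cong (λ n → N + n) (sym (#subseq-power⁺ x w)) ⟩
    N + (P + 1)          ≡⟨ sym (ℕ.+-assoc N P 1) ⟩
    N + P + 1            ≡⟨ cong (_+ 1) (trans (ℕ.+-comm N P) (#subseq-∁ (isPower⁺? x) (fromList w))) ⟩
    2 ^ length w + 1     ∎
    where
      open ≡-Reasoning
      N = #subseq (∁? (isPower⁺? x)) (fromList w)
      P = #subseq (isPower⁺? x) (fromList w)

  #lyndonFrom : Fin σ → Word σ → ℕ
  #lyndonFrom x w = #subseq (isLyndon? ∘ (x ∷_)) (fromList w)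

  #lyndonFrom≤#¬power⁺ : (x : Fin σ) (w : Word σ) → #lyndonFrom x w ≤ #subseq (∁? (isPower⁺? x)) (fromList w)
  #lyndonFrom≤#¬power⁺ x w =
    #subseq-mono (isLyndon? ∘ (x ∷_)) (∁? (isPower⁺? x)) (λ lyndon power → power⁺⇒¬lyndon power lyndon)
                 (fromList w)

  #lyndonFrom-bound : (x : Fin σ) (w : Word σ) → #lyndonFrom x w + 2 ^ occ x w ≤ 2 ^ length w + 1
  #lyndonFrom-bound x w =
    ℕ.≤-trans (ℕ.+-monoˡ-≤ (2 ^ occ x w) (#lyndonFrom≤#¬power⁺ x w)) (ℕ.≤-reflexive (#subseq-¬power⁺ x w))

  #lyndonFrom-sorted : {x : Fin σ} {w : Word σ} → Sorted (x ∷ w) → #lyndonFrom x w + 2 ^ occ x w ≡ 2 ^ length w + 1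
  #lyndonFrom-sorted {x} {w} sorted =
    trans (cong (_+ 2 ^ occ x w) (#subseq-cong (isLyndon? ∘ (x ∷_)) (∁? (isPower⁺? x)) (fromList w) (⊆ , ⊇)))
          (#subseq-¬power⁺ x w)
    where
      ⊆ : ∀ {s} → IsLyndon (x ∷ s) → ¬ IsPower⁺ x s
      ⊆ lyndon power = power⁺⇒¬lyndon power lyndon
      ⊇ : ∀ {S} → ¬ IsPower⁺ x (select (fromList w) S) → IsLyndon (x ∷ select (fromList w) S)
      ⊇ {S} = sorted∧¬power⁺⇒lyndon (AllPairs-resp-⊆ (refl ∷ select-⊆ w S) sorted)

  #lyndonFrom-descent : {x y : Fin σ} {w : Word σ} → y ∈ w → y Fin.< x →
                        #lyndonFrom x w + 2 ^ occ x w < 2 ^ length w + 1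
  #lyndonFrom-descent {x} {y} {w} y∈w y<x =
    ℕ.<-≤-trans (ℕ.+-monoˡ-< (2 ^ occ x w) #lyndonFrom<#¬power⁺) (ℕ.≤-reflexive (#subseq-¬power⁺ x w))
    where
      S = proj₁ (select-singleton y∈w)
      S≡y = proj₂ (select-singleton y∈w)
      #lyndonFrom<#¬power⁺ : #lyndonFrom x w < #subseq (∁? (isPower⁺? x)) (fromList w)
      #lyndonFrom<#¬power⁺ =
        #subseq-mono-< (isLyndon? ∘ (x ∷_)) (∁? (isPower⁺? x)) (λ lyndon power → power⁺⇒¬lyndon power lyndon)
          (fromList w) S
          (subst (∁ (IsPower⁺ x)) (sym S≡y) λ { (y≡x ∷ []) → Finₚ.<-irrefl y≡x y<x })
          (subst (λ s → ¬ IsLyndon (x ∷ s)) (sym S≡y) (descent⇒¬lyndon y<x))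

module _ {σ : ℕ} where

  Φ : Word σ → ℕ
  Φ w = ∑[ a < σ ] (2 ^ occ a w)

  Φ-∷ : (x : Fin σ) (w : Word σ) → Φ (x ∷ w) ≡ Φ w + 2 ^ occ x w
  Φ-∷ x w = ∑-update x (trans (cong (2 ^_) (occ-∷-≡ x w)) (cong (λ s → 2 ^ occ x w + s) (ℕ.+-identityʳ _)))
                       (λ a a≢x → cong (2 ^_) (occ-∷-≢ w a≢x))

  #lyndon+Φ-∷ : (x : Fin σ) (w : Word σ) →
    totalLyndonSubseq (x ∷ w) + Φ (x ∷ w) + 1 ≡ (#lyndonFrom x w + 2 ^ occ x w) + (totalLyndonSubseq w + Φ w + 1)
  #lyndon+Φ-∷ x w =
    trans (cong₂ (λ t f → t + f + 1) (#subseq-∷ isLyndon? x (fromList w)) (Φ-∷ x w))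
          (rearrange (#lyndonFrom x w) (totalLyndonSubseq w) (Φ w) (2 ^ occ x w))
    where
      rearrange : ∀ l t f e → l + t + (f + e) + 1 ≡ l + e + (t + f + 1)
      rearrange = solve-∀

  bound-suc : ∀ n → 2 ^ suc n + suc n + σ ≡ (2 ^ n + 1) + (2 ^ n + n + σ)
  bound-suc n = rearrange (2 ^ n) n σ
    where
      rearrange : ∀ P n σ → 2 * P + suc n + σ ≡ (P + 1) + (P + n + σ)
      rearrange = solve-∀

  #lyndon+Φ-[] : totalLyndonSubseq {σ} [] + Φ [] + 1 ≡ 2 ^ 0 + 0 + σ
  #lyndon+Φ-[] = trans (cong (_+ 1) (trans (∑-const σ 1) (ℕ.*-identityʳ σ))) (ℕ.+-comm σ 1)

  #lyndon+Φ-bound : (w : Word σ) → totalLyndonSubseq w + Φ w + 1 ≤ 2 ^ length w + length w + σ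
  #lyndon+Φ-bound []      = ℕ.≤-reflexive #lyndon+Φ-[]
  #lyndon+Φ-bound (x ∷ w) = begin
    totalLyndonSubseq (x ∷ w) + Φ (x ∷ w) + 1
      ≡⟨ #lyndon+Φ-∷ x w ⟩
    (#lyndonFrom x w + 2 ^ occ x w) + (totalLyndonSubseq w + Φ w + 1)
      ≤⟨ ℕ.+-mono-≤ (#lyndonFrom-bound x w) (#lyndon+Φ-bound w) ⟩
    (2 ^ length w + 1) + (2 ^ length w + length w + σ)
      ≡⟨ bound-suc (length w) ⟨
    2 ^ length (x ∷ w) + length (x ∷ w) + σ ∎
    where open ℕ.≤-Reasoning

  #lyndon+Φ-sorted : {w : Word σ} → Sorted w → totalLyndonSubseq w + Φ w + 1 ≡ 2 ^ length w + length w + σ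
  #lyndon+Φ-sorted {[]}    _               = #lyndon+Φ-[]
  #lyndon+Φ-sorted {x ∷ w} sorted@(_ ∷ sorted-w) = begin
    totalLyndonSubseq (x ∷ w) + Φ (x ∷ w) + 1
      ≡⟨ #lyndon+Φ-∷ x w ⟩
    (#lyndonFrom x w + 2 ^ occ x w) + (totalLyndonSubseq w + Φ w + 1)
      ≡⟨ cong₂ _+_ (#lyndonFrom-sorted sorted) (#lyndon+Φ-sorted sorted-w) ⟩
    (2 ^ length w + 1) + (2 ^ length w + length w + σ)
      ≡⟨ bound-suc (length w) ⟨
    2 ^ length (x ∷ w) + length (x ∷ w) + σ ∎
    where open ≡-Reasoning

  #lyndon+Φ-unsorted : {w : Word σ} → ¬ Sorted w → totalLyndonSubseq w + Φ w + 1 < 2 ^ length w + length w + σ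
  #lyndon+Φ-unsorted {[]}    unsorted = ⊥-elim (unsorted [])
  #lyndon+Φ-unsorted {x ∷ w} unsorted = begin-strict
    totalLyndonSubseq (x ∷ w) + Φ (x ∷ w) + 1
      ≡⟨ #lyndon+Φ-∷ x w ⟩
    (#lyndonFrom x w + 2 ^ occ x w) + (totalLyndonSubseq w + Φ w + 1)
      <⟨ split-< (All.all? (x Finₚ.≤?_) w) ⟩
    (2 ^ length w + 1) + (2 ^ length w + length w + σ)
      ≡⟨ bound-suc (length w) ⟨
    2 ^ length (x ∷ w) + length (x ∷ w) + σ ∎
    where
      open ℕ.≤-Reasoning
      split-< : Dec (All (x Fin.≤_) w) →
        (#lyndonFrom x w + 2 ^ occ x w) + (totalLyndonSubseq w + Φ w + 1)
          < (2 ^ length w + 1) + (2 ^ length w + length w + σ)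
      split-< (yes x≤w) = ℕ.+-mono-≤-< (#lyndonFrom-bound x w) (#lyndon+Φ-unsorted (unsorted ∘ (x≤w ∷_)))
      split-< (no x≰w)  with find (Allₚ.¬All⇒Any¬ (x Finₚ.≤?_) w x≰w)
      ... | y , y∈w , x≰y = ℕ.+-mono-<-≤ (#lyndonFrom-descent y∈w (ℕ.≰⇒> x≰y)) (#lyndon+Φ-bound w)

Balanced : ℕ → Word σ → Set
Balanced m w = ∀ a → occ a w ≡ m ⊎ occ a w ≡ suc m

module _ {σ : ℕ} (m p : ℕ) (w : Word σ) (|w|≡ : length w ≡ m * σ + p) where

  private
    X = σ * (m * 2 ^ m)

    ∑-chord : ∑[ a < σ ] (2 ^ m * (1 + occ a w)) ≡ (p + σ) * 2 ^ m + X
    ∑-chord = begin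
      ∑[ a < σ ] (2 ^ m * (1 + occ a w))    ≡⟨ ∑-*-distribˡ (2 ^ m) (λ a → 1 + occ a w) ⟩
      2 ^ m * ∑[ a < σ ] (1 + occ a w)      ≡⟨ cong (2 ^ m *_) (∑-distrib-+ (λ _ → 1) (λ a → occ a w)) ⟩
      2 ^ m * (∑[ a < σ ] 1 + ∑[ a < σ ] occ a w) ≡⟨ cong (λ s → 2 ^ m * (s + ∑[ a < σ ] occ a w)) (∑-const σ 1) ⟩
      2 ^ m * (σ * 1 + ∑[ a < σ ] occ a w)  ≡⟨ cong (λ s → 2 ^ m * (σ * 1 + s)) (trans (∑-occ w) |w|≡) ⟩
      2 ^ m * (σ * 1 + (m * σ + p))         ≡⟨ rearrange (2 ^ m) σ m p ⟩
      (p + σ) * 2 ^ m + X                   ∎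
      where
        open ≡-Reasoning
        rearrange : ∀ P σ m p → P * (σ * 1 + (m * σ + p)) ≡ (p + σ) * P + σ * (m * P)
        rearrange = solve-∀

    ∑-2^occ : ∑[ a < σ ] (2 ^ occ a w + m * 2 ^ m) ≡ Φ w + X
    ∑-2^occ = trans (∑-distrib-+ (λ a → 2 ^ occ a w) (λ _ → m * 2 ^ m))
                    (cong (λ s → Φ w + s) (∑-const σ (m * 2 ^ m)))

  Φ-lower-bound : (p + σ) * 2 ^ m ≤ Φ w
  Φ-lower-bound = ℕ.+-cancelʳ-≤ X _ _ (begin
    (p + σ) * 2 ^ m + X                   ≡⟨ ∑-chord ⟨
    ∑[ a < σ ] (2 ^ m * (1 + occ a w))    ≤⟨ ∑-mono-≤ (λ a → 2^-chord-≤ m (occ a w)) ⟩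
    ∑[ a < σ ] (2 ^ occ a w + m * 2 ^ m)  ≡⟨ ∑-2^occ ⟩
    Φ w + X                               ∎)
    where open ℕ.≤-Reasoning

  Φ-balanced : Balanced m w → Φ w ≡ (p + σ) * 2 ^ m
  Φ-balanced balanced = ℕ.+-cancelʳ-≡ X _ _ (begin
    Φ w + X                               ≡⟨ ∑-2^occ ⟨
    ∑[ a < σ ] (2 ^ occ a w + m * 2 ^ m)  ≡⟨ sum-cong-≗ (λ a → 2^-chord-≡ m (balanced a)) ⟨
    ∑[ a < σ ] (2 ^ m * (1 + occ a w))    ≡⟨ ∑-chord ⟩
    (p + σ) * 2 ^ m + X                   ∎)
    where open ≡-Reasoning

  Φ-unbalanced : (a : Fin σ) → occ a w ≢ m → occ a w ≢ suc m → (p + σ) * 2 ^ m < Φ w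
  Φ-unbalanced a ≢m ≢1+m = ℕ.+-cancelʳ-< X _ _ (begin-strict
    (p + σ) * 2 ^ m + X                   ≡⟨ ∑-chord ⟨
    ∑[ a < σ ] (2 ^ m * (1 + occ a w))    <⟨ ∑-mono-< (λ b → 2^-chord-≤ m (occ b w)) a (2^-chord-< m ≢m ≢1+m) ⟩
    ∑[ a < σ ] (2 ^ occ a w + m * 2 ^ m)  ≡⟨ ∑-2^occ ⟩
    Φ w + X                               ∎)
    where open ℕ.≤-Reasoning

module _ {σ : ℕ} (m p : ℕ) (w : Word σ) (|w|≡ : length w ≡ m * σ + p) where

  lyndon-bound : totalLyndonSubseq w + (p + σ) * 2 ^ m + 1 ≤ 2 ^ length w + length w + σ
  lyndon-bound = ℕ.≤-trans (ℕ.+-monoˡ-≤ 1 (ℕ.+-monoʳ-≤ (totalLyndonSubseq w) (Φ-lower-bound m p w |w|≡)))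
                           (#lyndon+Φ-bound w)

  lyndon-bound-attained : Sorted w → Balanced m w →
    totalLyndonSubseq w + (p + σ) * 2 ^ m + 1 ≡ 2 ^ length w + length w + σ
  lyndon-bound-attained sorted balanced =
    trans (cong (λ f → totalLyndonSubseq w + f + 1) (sym (Φ-balanced m p w |w|≡ balanced)))
          (#lyndon+Φ-sorted sorted)

  lyndon-bound-attained⇒ : totalLyndonSubseq w + (p + σ) * 2 ^ m + 1 ≡ 2 ^ length w + length w + σ →
                           Sorted w × Balanced m w
  lyndon-bound-attained⇒ attained = sorted (allPairs? Finₚ._≤?_ w) , balanced
    where
      T = totalLyndonSubseq w
      sorted : Dec (Sorted w) → Sorted w
      sorted (yes s)        = s
      sorted (no unsorted) = ⊥-elim (ℕ.<-irrefl attained (begin-strict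
        T + (p + σ) * 2 ^ m + 1         ≤⟨ ℕ.+-monoˡ-≤ 1 (ℕ.+-monoʳ-≤ T (Φ-lower-bound m p w |w|≡)) ⟩
        T + Φ w + 1                     <⟨ #lyndon+Φ-unsorted unsorted ⟩
        2 ^ length w + length w + σ     ∎))
        where open ℕ.≤-Reasoning
      balanced : Balanced m w
      balanced a with occ a w ℕ.≟ m | occ a w ℕ.≟ suc m
      ... | yes ≡m | _       = inj₁ ≡m
      ... | no _   | yes ≡1+m = inj₂ ≡1+m
      ... | no ≢m  | no ≢1+m  = ⊥-elim (ℕ.<-irrefl attained (begin-strict
        T + (p + σ) * 2 ^ m + 1         <⟨ ℕ.+-monoˡ-< 1 (ℕ.+-monoʳ-< T (Φ-unbalanced m p w |w|≡ a ≢m ≢1+m)) ⟩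
        T + Φ w + 1                     ≤⟨ #lyndon+Φ-bound w ⟩
        2 ^ length w + length w + σ     ∎))
        where open ℕ.≤-Reasoning

module _ (σ m p : ℕ) where

  private
    occ-extremalWord-< : (a : Fin σ) → toℕ a < σ ∸ p → occ a (extremalWord σ m p) ≡ m
    occ-extremalWord-< a a< rewrite (occ a (extremalWord σ m p) ≡ _ ∋ occ-blockWord _ a) with toℕ a ℕ.<? σ ∸ p
    ... | yes _  = refl
    ... | no a≮ = ⊥-elim (a≮ a<)

    occ-extremalWord-≥ : (a : Fin σ) → σ ∸ p ≤ toℕ a → occ a (extremalWord σ m p) ≡ suc m
    occ-extremalWord-≥ a a≥ rewrite (occ a (extremalWord σ m p) ≡ _ ∋ occ-blockWord _ a) with toℕ a ℕ.<? σ ∸ p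
    ... | yes a< = ⊥-elim (ℕ.≤⇒≯ a≥ a<)
    ... | no _   = refl

  extremalWord-sorted : Sorted (extremalWord σ m p)
  extremalWord-sorted = blockWord-sorted _

  extremalWord-balanced : Balanced m (extremalWord σ m p)
  extremalWord-balanced a with toℕ a ℕ.<? σ ∸ p
  ... | yes a< = inj₁ (occ-extremalWord-< a a<)
  ... | no a≮  = inj₂ (occ-extremalWord-≥ a (ℕ.≮⇒≥ a≮))

  length-extremalWord : p ≤ σ → length (extremalWord σ m p) ≡ m * σ + p
  length-extremalWord p≤σ = begin
    length (extremalWord σ m p)            ≡⟨ ∑-occ (extremalWord σ m p) ⟨
    ∑[ a < σ ] occ a (extremalWord σ m p)  ≡⟨ ∑-threshold σ m (ℕ.m∸n≤m σ p) occ-extremalWord-< occ-extremalWord-≥ ⟩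
    σ * m + (σ ∸ (σ ∸ p))                  ≡⟨ cong₂ _+_ (ℕ.*-comm σ m) (ℕ.m∸[m∸n]≡n p≤σ) ⟩
    m * σ + p                              ∎
    where open ≡-Reasoning

level : ℕ → Bool → ℕ
level m true  = suc m
level m false = m

level-balanced : (m : ℕ) (x : Bool) → level m x ≡ m ⊎ level m x ≡ suc m
level-balanced m true  = inj₂ refl
level-balanced m false = inj₁ refl

level-injective : (m : ℕ) {x y : Bool} → level m x ≡ level m y → x ≡ y
level-injective m {true}  {true}  _  = refl
level-injective m {false} {false} _  = refl
level-injective m {true}  {false} eq = ⊥-elim (ℕ.1+n≢n eq)
level-injective m {false} {true}  eq = ⊥-elim (ℕ.1+n≢n (sym eq))

levels : ℕ → Subset σ → Fin σ → ℕ
levels m b a = level m (lookup b a)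

∑-levels : (m : ℕ) (b : Subset σ) → ∑[ a < σ ] levels m b a ≡ σ * m + ∣ b ∣
∑-levels m []          = refl
∑-levels {suc σ} m (true ∷ b) = trans (cong (λ s → suc m + s) (∑-levels m b)) (rearrange m (σ * m) ∣ b ∣)
  where
    rearrange : ∀ m s k → suc m + (s + k) ≡ m + s + suc k
    rearrange = solve-∀
∑-levels m (false ∷ b) = trans (cong (λ s → m + s) (∑-levels m b)) (sym (ℕ.+-assoc m _ ∣ b ∣))

module _ {σ : ℕ} (m : ℕ) where

  levelWord : Subset σ → Word σ
  levelWord b = blockWord (levels m b)

  length-levelWord : (b : Subset σ) → length (levelWord b) ≡ σ * m + ∣ b ∣
  length-levelWord b = begin
    length (levelWord b)          ≡⟨ ∑-occ (levelWord b) ⟨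
    ∑[ a < σ ] occ a (levelWord b) ≡⟨ sum-cong-≗ (occ-blockWord (levels m b)) ⟩
    ∑[ a < σ ] levels m b a       ≡⟨ ∑-levels m b ⟩
    σ * m + ∣ b ∣                 ∎
    where open ≡-Reasoning

  levelWord-balanced : (b : Subset σ) → Balanced m (levelWord b)
  levelWord-balanced b a =
    subst (λ c → c ≡ m ⊎ c ≡ suc m) (sym (occ-blockWord (levels m b) a)) (level-balanced m (lookup b a))

  levelWord-injective : {b c : Subset σ} → levelWord b ≡ levelWord c → b ≡ c
  levelWord-injective {b} {c} eq = begin
    b                   ≡⟨ Vecₚ.tabulate∘lookup b ⟨
    tabulate (lookup b) ≡⟨ Vecₚ.tabulate-cong (λ a → level-injective m (levels≡ a)) ⟩
    tabulate (lookup c) ≡⟨ Vecₚ.tabulate∘lookup c ⟩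
    c                   ∎
    where
      open ≡-Reasoning
      levels≡ : ∀ a → levels m b a ≡ levels m c a
      levels≡ a =
        trans (sym (occ-blockWord (levels m b) a)) (trans (cong (occ a) eq) (occ-blockWord (levels m c) a))

  topLetters : Word σ → Subset σ
  topLetters z = tabulate (λ a → does (occ a z ℕ.≟ suc m))

  sorted∧balanced⇒levelWord : {z : Word σ} → Sorted z → Balanced m z → z ≡ levelWord (topLetters z)
  sorted∧balanced⇒levelWord {z} sorted balanced =
    sorted-unique sorted (blockWord-sorted _) (λ a → trans (occ≡level a) (sym (occ-blockWord _ a)))
    where
      level-of : {c : ℕ} → c ≡ m ⊎ c ≡ suc m → c ≡ level m (does (c ℕ.≟ suc m))
      level-of (inj₁ refl) = cong (level m) (sym (dec-false (m ℕ.≟ suc m) (ℕ.1+n≢n ∘ sym)))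
      level-of (inj₂ refl) = cong (level m) (sym (dec-true (suc m ℕ.≟ suc m) refl))
      occ≡level : ∀ a → occ a z ≡ levels m (topLetters z) a
      occ≡level a = trans (level-of (balanced a))
                          (cong (level m) (sym (Vecₚ.lookup∘tabulate (λ a → does (occ a z ℕ.≟ suc m)) a)))

∈-allStrings⁻ : {w : Word σ} → w ∈ allStrings σ n → length w ≡ n
∈-allStrings⁻ w∈ with ∈-map⁻ toList w∈
... | v , _ , refl = Vecₚ.length-toList v

∈-allStrings⁺ : (w : Word σ) → length w ≡ n → w ∈ allStrings σ n
∈-allStrings⁺ {σ} w refl =
  subst (_∈ allStrings σ (length w)) (Vecₚ.toList∘fromList w) (∈-map⁺ toList (∈-allVecs ∈-allFin (fromList w)))

allStrings-unique : ∀ σ n → Unique (allStrings σ n)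
allStrings-unique σ n =
  Uniqueₚ.map⁺ (λ {u} {v} eq → trans (sym (Vecₚ.cast-is-id refl u)) (Vecₚ.toList-injective refl u v eq))
    (allVecs-unique (Uniqueₚ.allFin⁺ σ) n)

foldr-⊔-≡ : {b : ℕ} {xs : List ℕ} → All (_≤ b) xs → b ∈ xs → foldr _⊔_ 0 xs ≡ b
foldr-⊔-≡ {b} xs≤b b∈xs = ℕ.≤-antisym (Listₚ.foldr-preservesᵇ ℕ.⊔-lub z≤n xs≤b) (≤-foldr-⊔ b∈xs)
  where
    ≤-foldr-⊔ : {xs : List ℕ} → b ∈ xs → b ≤ foldr _⊔_ 0 xs
    ≤-foldr-⊔ (here refl)  = ℕ.m≤m⊔n _ _
    ≤-foldr-⊔ (there b∈xs) = ℕ.≤-trans (≤-foldr-⊔ b∈xs) (ℕ.m≤n⊔m _ _)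

module _ (σ n m p : ℕ) (n≡ : n ≡ m * σ + p) (p≤σ : p ≤ σ) where

  private
    K = (p + σ) * 2 ^ m
    T = totalLyndonSubseq {σ}
    ext = extremalWord σ m p

    lyndon-bound-n : (w : Word σ) → length w ≡ n → T w + K + 1 ≤ 2 ^ n + n + σ
    lyndon-bound-n w refl = lyndon-bound m p w n≡

  length-extremalWord≡n : length (extremalWord σ m p) ≡ n
  length-extremalWord≡n = trans (length-extremalWord σ m p p≤σ) (sym n≡)

  private
    ext-attains : T ext + K + 1 ≡ 2 ^ n + n + σ
    ext-attains = trans (lyndon-bound-attained m p ext (length-extremalWord σ m p p≤σ)
                                               (extremalWord-sorted σ m p) (extremalWord-balanced σ m p))
                        (cong (λ k → 2 ^ k + k + σ) length-extremalWord≡n)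

  MTS≡extremal : MTS σ n ≡ totalLyndonSubseq (extremalWord σ m p)
  MTS≡extremal = foldr-⊔-≡ (Allₚ.map⁺ (All.tabulate (λ {w} w∈ → ≤-ext {w} (∈-allStrings⁻ w∈))))
                           (∈-map⁺ T (∈-allStrings⁺ ext length-extremalWord≡n))
    where
      ≤-ext : {w : Word σ} → length w ≡ n → T w ≤ T ext
      ≤-ext {w} |w|≡n = ℕ.+-cancelʳ-≤ K _ _ (ℕ.+-cancelʳ-≤ 1 _ _
                          (ℕ.≤-trans (lyndon-bound-n w |w|≡n) (ℕ.≤-reflexive (sym ext-attains))))

  MTS-formula : MTS σ n + (p + σ) * 2 ^ m + 1 ≡ 2 ^ n + n + σ
  MTS-formula = trans (cong (λ t → t + K + 1) MTS≡extremal) ext-attains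

  maximal⇔sorted×balanced : (w : Word σ) → length w ≡ n →
                            (totalLyndonSubseq w ≡ MTS σ n) ⇔ (Sorted w × Balanced m w)
  maximal⇔sorted×balanced w refl = mk⇔
    (λ T≡ → lyndon-bound-attained⇒ m p w n≡ (trans (cong (λ t → t + K + 1) T≡) MTS-formula))
    (λ (sorted , balanced) → ℕ.+-cancelʳ-≡ K _ _ (ℕ.+-cancelʳ-≡ 1 _ _
       (trans (lyndon-bound-attained m p w n≡ sorted balanced) (sym MTS-formula))))

  private
    maximal? : (w : Word σ) → Dec (T w ≡ MTS σ n)
    maximal? w = T w ℕ.≟ MTS σ n

    size-p? : (b : Subset σ) → Dec (∣ b ∣ ≡ p)
    size-p? b = ∣ b ∣ ℕ.≟ p

    maximalWords : List (Word σ)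
    maximalWords = filter maximal? (allStrings σ n)

    levelWords : List (Word σ)
    levelWords = map (levelWord m) (filter size-p? (subsets σ))

    σ*m+p≡n : σ * m + p ≡ n
    σ*m+p≡n = trans (cong (_+ p) (ℕ.*-comm σ m)) (sym n≡)

    maximal⇒level : {z : Word σ} → z ∈ maximalWords → z ∈ levelWords
    maximal⇒level {z} z∈ with ∈-filter⁻ maximal? {xs = allStrings σ n} z∈
    ... | z∈strings , maximal
      with Equivalence.to (maximal⇔sorted×balanced z (∈-allStrings⁻ z∈strings)) maximal
    ... | sorted , balanced =
      subst (_∈ levelWords) (sym z≡) (∈-map⁺ (levelWord m) (∈-filter⁺ size-p? (∈-subsets (topLetters m z)) size≡p))
      where
        z≡ = sorted∧balanced⇒levelWord m sorted balanced
        size≡p : ∣ topLetters m z ∣ ≡ p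
        size≡p = ℕ.+-cancelˡ-≡ (σ * m) _ _
          (trans (sym (length-levelWord m (topLetters m z)))
                 (trans (cong length (sym z≡)) (trans (∈-allStrings⁻ z∈strings) (sym σ*m+p≡n))))

    level⇒maximal : {z : Word σ} → z ∈ levelWords → z ∈ maximalWords
    level⇒maximal z∈ with ∈-map⁻ (levelWord m) z∈
    ... | b , b∈ , refl = ∈-filter⁺ maximal? (∈-allStrings⁺ _ |z|≡n)
      (Equivalence.from (maximal⇔sorted×balanced _ |z|≡n) (blockWord-sorted _ , levelWord-balanced m b))
      where
        |z|≡n = trans (length-levelWord m b)
                      (trans (cong (λ k → σ * m + k) (proj₂ (∈-filter⁻ size-p? {xs = subsets σ} b∈))) σ*m+p≡n)

    maximalWords-unique : Unique maximalWords
    maximalWords-unique = Uniqueₚ.filter⁺ maximal? (allStrings-unique σ n)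

    levelWords-unique : Unique levelWords
    levelWords-unique = Uniqueₚ.map⁺ (levelWord-injective m) (Uniqueₚ.filter⁺ size-p? (subsets-unique σ))

  numMaximal≡ : numMaximal σ n ≡ σ C p
  numMaximal≡ = begin
    length maximalWords                     ≡⟨ ↭-length (∼bag⇒↭ maximal∼level) ⟩
    length levelWords                       ≡⟨ Listₚ.length-map (levelWord m) (filter size-p? (subsets σ)) ⟩
    length (filter size-p? (subsets σ))     ≡⟨ #subsets-of-size σ p ⟩
    σ C p                                   ∎
    where
      open ≡-Reasoning
      maximal∼level = unique∧set⇒bag maximalWords-unique levelWords-unique (mk⇔ maximal⇒level level⇒maximal)

ℕ-equation⇒ℤ : {x k a b c : ℕ} → x + k + 1 ≡ a + b + c → + x ≡ (((+ a ℤ.- + k) ℤ.+ + b) ℤ.+ + c) ℤ.- + 1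
ℕ-equation⇒ℤ {x} {k} {a} {b} {c} eq = begin
  + x                                        ≡⟨ isolate (+ x) (+ k) ⟩
  (+ x ℤ.+ + k ℤ.+ + 1) ℤ.- + k ℤ.- + 1
    ≡⟨ cong (λ z → z ℤ.- + k ℤ.- + 1) (trans (sym (pos-+-+ x k 1)) (trans (cong +_ eq) (pos-+-+ a b c))) ⟩
  (+ a ℤ.+ + b ℤ.+ + c) ℤ.- + k ℤ.- + 1      ≡⟨ reorder (+ a) (+ b) (+ c) (+ k) ⟩
  (((+ a ℤ.- + k) ℤ.+ + b) ℤ.+ + c) ℤ.- + 1  ∎
  where
    open ≡-Reasoning
    pos-+-+ : ∀ x y z → + (x + y + z) ≡ + x ℤ.+ + y ℤ.+ + z
    pos-+-+ x y z = trans (ℤₚ.pos-+ (x + y) z) (cong (ℤ._+ + z) (ℤₚ.pos-+ x y))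
    isolate : ∀ x k → x ≡ (x ℤ.+ k ℤ.+ + 1) ℤ.- k ℤ.- + 1
    isolate = ℤ-Solver.solve-∀
    reorder : ∀ a b c k → (a ℤ.+ b ℤ.+ c) ℤ.- k ℤ.- + 1 ≡ (((a ℤ.- k) ℤ.+ b) ℤ.+ c) ℤ.- + 1
    reorder = ℤ-Solver.solve-∀

mainTheorem1 : (σ n m p : ℕ) → σ < n → n ≡ m * σ + p → p < σ →
    (+ MTS σ n ≡ ((((+ (2 ^ n)) ℤ.- (+ ((p + σ) * 2 ^ m))) ℤ.+ (+ n)) ℤ.+ (+ σ)) ℤ.- (+ 1))
    × (numMaximal σ n ≡ σ C p)
    × (length (extremalWord σ m p) ≡ n)
    × (totalLyndonSubseq (extremalWord σ m p) ≡ MTS σ n)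
mainTheorem1 σ n m p _ n≡ p<σ =
    ℕ-equation⇒ℤ (MTS-formula σ n m p n≡ p≤σ)
  , numMaximal≡ σ n m p n≡ p≤σ
  , length-extremalWord≡n σ n m p n≡ p≤σ
  , sym (MTS≡extremal σ n m p n≡ p≤σ)
  where
    p≤σ = ℕ.<⇒≤ p<σ
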